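{- Let $U,U',L\in\mathcal{P}(n,d)$ such that $U$ is weakly above $U'$ and $U'$ is weakly above $L$. Then the restriction of $\Lambda_{M[U,L]}$ to the set of bases of $M[U',L]$ equals $\Lambda_{M[U',L]}$. In particular, $\mathcal{S}_{\mathsf{lex}}(M[U',L])\subseteq\mathcal{S}_{\mathsf{lex}}(M[U,L])$.
   Context: $\mathcal{P}(n,d)$ is the set of words of length $n$ in $\mathbf{e}$ and $\mathbf{n}$ with exactly $d$ letters $\mathbf{e}$ (lattice paths from $(0,0)$ to $(d,n-d)$); $E(C)\subseteq[n]$ is the set of positions of $\mathbf{e}$'s of $C$. $U$ is weakly above $L$ if every prefix of $L$ has at least as many $\mathbf{e}$'s as the equally long prefix of $U$; $\mathcal{P}[U,L]$ is the set of paths weakly below $U$ and weakly above $L$; $M[U,L]$ is the matroid on $[n]$ with bases $\{E(C):C\in\mathcal{P}[U,L]\}$. For a matroid $M$ on finite $E\subseteq\mathbb{N}$ with bases $\mathcal{B}(M)$, $\mathcal{S}_{\mathsf{lex}}(M)=\{\tau\subseteq E:\prod_{i\in\tau}x_i\notin\mathrm{in}_{\mathsf{lex}}(I(V_M))\}$ with $V_M=\{\mathbf{e}_B:B\in\mathcal{B}(M)\}$, $I(V_M)$ its vanishing ideal, $\mathsf{lex}$ the lexicographic order with $x_i\succ x_j$ for $i<j$. $\{\Lambda_M\}$ is the unique family (over all matroids with finite groundset in $\mathbb{N}$) of bijections $\Lambda_M:\mathcal{B}(M)\to\mathcal{S}_{\mathsf{lex}}(M)$ with $\Lambda_M(B)\subseteq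 B$ and, for nonempty groundset with largest element $m$, $\Lambda_M(B)=\Lambda_{M\setminus m}(B)$ if $m\notin B$, $\Lambda_M(B)\setminus\{m\}=\Lambda_{M/m}(B\setminus\{m\})$ if $m\in B$. -}

module Defs where

open import Data.Bool using (Bool; true; false; if_then_else_; not; _∧_)
open import Data.Bool.Properties using () renaming (_≟_ to _≟ᵇ_)
open import Data.Nat using (ℕ; zero; suc; _≤_; _≤?_; _>_)
open import Data.Nat.Properties using () renaming (_≟_ to _≟ℕ_)
open import Data.Fin using (Fin; toℕ)
open import Data.Fin.Properties using (all?)
open import Data.Vec using (Vec; []; _∷_; init; last; lookup; _[_]≔_; map)
open import Data.Vec.Properties using (≡-dec)
open import Data.Vec.Relation.Binary.Pointwise.Inductive using (Pointwise)
open import Data.List using (List; []; _∷_; _++_; filter; filterᵇ) renaming (map to mapL)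
open import Data.Bool.ListAction using (any)
open import Data.List.Membership.Propositional using (_∈_)
open import Data.Product using (Σ; _×_; _,_; ∃)
open import Data.Rational using (ℚ; 0ℚ; 1ℚ; _+_; _*_)
open import Relation.Nullary using (¬_; Dec; yes; no; does)
open import Relation.Nullary.Decidable using (_×-dec_)
open import Relation.Binary.PropositionalEquality using (_≡_; _≢_)

-- Subsets of the groundset [k] = {1,…,k}: Vec Bool k, where position
-- i (Fin index i, i.e. element i+1) is 'true' iff the element belongs.

Sub : ℕ → Set
Sub k = Vec Bool k

_∈ˢ_ : ∀ {k} → Fin k → Sub k → Set
i ∈ˢ B = lookup B i ≡ true

_⊆ˢ_ : ∀ {k} → Sub k → Sub k → Set
A ⊆ˢ B = ∀ i → i ∈ˢ A → i ∈ˢ B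

allSubs : (k : ℕ) → List (Sub k)
allSubs zero = [] ∷ []
allSubs (suc k) = mapL (false ∷_) (allSubs k) ++ mapL (true ∷_) (allSubs k)

record IsMatroid {k : ℕ} (Bs : List (Sub k)) : Set where
  field
    nonempty : ∃ λ B → B ∈ Bs
    exchange : ∀ B₁ B₂ → B₁ ∈ Bs → B₂ ∈ Bs → ∀ i → i ∈ˢ B₁ → ¬ (i ∈ˢ B₂) →
               Σ (Fin k) λ j → j ∈ˢ B₂ × ¬ (j ∈ˢ B₁) ×
                 (((B₁ [ i ]≔ false) [ j ]≔ true) ∈ Bs)

-- deletion M \ m and contraction M / m of the largest element m = k+1
-- (M \ m = M / m if m is a coloop; M / m = M \ m if m is a loop)
deleteLast : ∀ {k} → List (Sub (suc k)) → List (Sub k)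
deleteLast Bs with any (λ B → not (last B)) Bs
... | true  = mapL init (filterᵇ (λ B → not (last B)) Bs)
... | false = mapL init Bs

contractLast : ∀ {k} → List (Sub (suc k)) → List (Sub k)
contractLast Bs with any last Bs
... | true  = mapL init (filterᵇ last Bs)
... | false = mapL init Bs

-- Polynomials over ℚ in variables x_i (i ∈ [k]): finite lists of terms
-- (coefficient, exponent vector); the polynomial is the sum of its terms.

Mono : ℕ → Set
Mono k = Vec ℕ k

Poly : ℕ → Set
Poly k = List (ℚ × Mono k)

coeff : ∀ {k} → Poly k → Mono k → ℚ
coeff [] a = 0ℚ
coeff ((c , b) ∷ f) a with does (≡-dec _≟ℕ_ b a)
... | true  = c + coeff f a
... | false = coeff f a

pow : ℚ → ℕ → ℚ
pow q zero = 1ℚ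
pow q (suc e) = q * pow q e

bool→ℚ : Bool → ℚ
bool→ℚ true = 1ℚ
bool→ℚ false = 0ℚ

evalMono : ∀ {k} → Vec ℚ k → Mono k → ℚ
evalMono [] [] = 1ℚ
evalMono (p ∷ ps) (e ∷ es) = pow p e * evalMono ps es

eval : ∀ {k} → Poly k → Vec ℚ k → ℚ
eval [] p = 0ℚ
eval ((c , b) ∷ f) p = c * evalMono p b + eval f p

indicator : ∀ {k} → Sub k → Vec ℚ k
indicator B = map bool→ℚ B

data _≻lex_ : ∀ {k} → Mono k → Mono k → Set where
  here : ∀ {k x y} {a b : Mono k} → x > y → (x ∷ a) ≻lex (y ∷ b)
  there : ∀ {k x} {a b : Mono k} → a ≻lex b → (x ∷ a) ≻lex (x ∷ b)

IsLeadingMono : ∀ {k} → Poly k → Mono k → Set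
IsLeadingMono f a = coeff f a ≢ 0ℚ × (∀ b → b ≻lex a → coeff f b ≡ 0ℚ)

Vanishes : ∀ {k} → List (Sub k) → Poly k → Set
Vanishes Bs f = ∀ B → B ∈ Bs → eval f (indicator B) ≡ 0ℚ

-- the monomial x^m lies in in_lex(I(V_M)), the monomial ideal generated
-- by the lex-leading monomials of nonzero elements of I(V_M)
InInitIdeal : ∀ {k} → List (Sub k) → Mono k → Set
InInitIdeal Bs m = Σ (Poly _) λ f → Σ (Mono _) λ a →
  Vanishes Bs f × IsLeadingMono f a × Pointwise _≤_ a m

sqfree : ∀ {k} → Sub k → Mono k
sqfree τ = map (λ b → if b then 1 else 0) τ

Slex : ∀ {k} → List (Sub k) → Sub k → Set
Slex Bs τ = ¬ InInitIdeal Bs (sqfree τ)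

-- The family {Λ_M} (restricted to matroids with groundset [k], k ∈ ℕ,
-- which is closed under deleting/contracting the largest element).

LamFam : Set
LamFam = ∀ k → List (Sub k) → Sub k → Sub k

record IsLambdaFamily (Λ : LamFam) : Set where
  field
    subset   : ∀ k (Bs : List (Sub k)) → IsMatroid Bs → ∀ B → B ∈ Bs → Λ k Bs B ⊆ˢ B
    into     : ∀ k (Bs : List (Sub k)) → IsMatroid Bs → ∀ B → B ∈ Bs → Slex Bs (Λ k Bs B)
    injective : ∀ k (Bs : List (Sub k)) → IsMatroid Bs → ∀ B B' → B ∈ Bs → B' ∈ Bs →
                Λ k Bs B ≡ Λ k Bs B' → B ≡ B'
    onto     : ∀ k (Bs : List (Sub k)) → IsMatroid Bs → ∀ τ → Slex Bs τ →
               Σ (Sub k) λ B → B ∈ Bs × Λ k Bs B ≡ τ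
    recDel   : ∀ k (Bs : List (Sub (suc k))) → IsMatroid Bs → ∀ B → B ∈ Bs →
               last B ≡ false →
               Λ (suc k) Bs B ≡ Data.Vec._∷ʳ_ (Λ k (deleteLast Bs) (init B)) false
    recCon   : ∀ k (Bs : List (Sub (suc k))) → IsMatroid Bs → ∀ B → B ∈ Bs →
               last B ≡ true →
               init (Λ (suc k) Bs B) ≡ Λ k (contractLast Bs) (init B)

-- Lattice paths: words in e (= true) and n (= false)

countE : ∀ {n} → Vec Bool n → ℕ
countE [] = 0
countE (true ∷ w) = suc (countE w)
countE (false ∷ w) = countE w

InP : (n d : ℕ) → Vec Bool n → Set
InP n d C = countE C ≡ d

pre : ∀ {n} → ℕ → Vec Bool n → ℕ
pre zero w = 0
pre (suc j) [] = 0
pre (suc j) (true ∷ w) = suc (pre j w)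
pre (suc j) (false ∷ w) = pre j w

WeaklyAbove : ∀ {n} → Vec Bool n → Vec Bool n → Set
WeaklyAbove {n} U L = ∀ (j : Fin (suc n)) → pre (toℕ j) U ≤ pre (toℕ j) L

weaklyAbove? : ∀ {n} (U L : Vec Bool n) → Dec (WeaklyAbove U L)
weaklyAbove? U L = all? (λ j → pre (toℕ j) U ≤? pre (toℕ j) L)

InPUL : (n d : ℕ) → Vec Bool n → Vec Bool n → Vec Bool n → Set
InPUL n d U L C = InP n d C × WeaklyAbove U C × WeaklyAbove C L

inPUL? : ∀ n d U L C → Dec (InPUL n d U L C)
inPUL? n d U L C = (countE C ≟ℕ d) ×-dec (weaklyAbove? U C ×-dec weaklyAbove? C L)

-- bases of M[U,L] (E(C) is C itself, as the subset of e-positions)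
basesUL : (n d : ℕ) → Vec Bool n → Vec Bool n → List (Sub n)
basesUL n d U L = filter (inPUL? n d U L) (allSubs n)

module Submission where

-- Both matroids are regions: words with d letters e whose prefix counts satisfy u ≤ pre ≤ l.
-- Regions are matroids (the exchange moves an e to the nearest crossing of the two paths), and
-- deleting or contracting the last element gives regions again, so we induct on n along the
-- recursion defining Λ. For a basis B containing the last element, init (Λ B) comes from the
-- contraction, and the last element lies in Λ B iff init (Λ B) is a face of S_lex of the deletion.
-- This test agrees for the two matroids by an interval property: a common face of the regions
-- (d₁, u₁) and (d₂, u₂) with d₂ ≤ k ≤ d₁ is a face of (k, u₂). That follows by induction on n from
-- S(M) = S(M∖m)·0 ∪ S(M/m)·0 ∪ (S(M∖m) ∩ S(M/m))·1, which Λ being a bijection yields. The inclusion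
-- of S_lex holds because fewer bases give a larger vanishing ideal.

open import Defs
open import Data.Bool using (Bool; true; false; not; T)
open import Data.Bool.ListAction using (any)
open import Data.Bool.Properties using (T-≡; ¬-not)
open import Data.Empty using (⊥; ⊥-elim)
open import Data.Fin using (Fin; zero; suc; toℕ; fromℕ<)
open import Data.Fin.Properties using (toℕ<n; toℕ-fromℕ<)
open import Data.List using (List; []; _∷_; filter; filterᵇ) renaming (map to mapL)
open import Data.List.Membership.Propositional using (_∈_)
open import Data.List.Membership.Propositional.Properties
  using (∈-filter⁺; ∈-filter⁻; ∈-map⁺; ∈-map⁻; ∈-++⁺ˡ; ∈-++⁺ʳ)
open import Data.List.Relation.Unary.Any using (here; there)
open import Data.Nat using (ℕ; zero; suc; _≤_; _<_; z≤n; s≤s; _+_; _∸_; _≤?_; _<?_)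
open import Data.Nat.Properties
  using (≤-refl; ≤-trans; ≤-reflexive; ≤-antisym; ≤-pred; <-trans; <-irrefl; <-≤-trans; n≤1+n; m≤n⇒m≤1+n;
         ≰⇒>; ≮⇒≥; m≤n⇒m<n∨m≡n; m∸n+n≡m; m≤n+m; +-suc; ≤-total; <⇒≤; n≤0⇒n≡0; allUpTo?; _≟_)
open import Data.Product using (Σ; _×_; _,_; ∃; proj₁; proj₂)
open import Data.Rational using (1ℚ; 0ℚ)
open import Data.Rational.Properties using (+-identityʳ)
open import Data.Sum using (_⊎_; inj₁; inj₂)
open import Data.Unit using (tt)
open import Data.Vec using (Vec; []; _∷_; init; last; _∷ʳ_; initLast; lookup; _[_]≔_; replicate)
open import Data.Vec.Properties using (lookup∘update′; init-∷ʳ; last-∷ʳ; ∷ʳ-injectiveʳ; ≡-dec)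
open import Data.Vec.Relation.Binary.Pointwise.Inductive using (Pointwise; []; _∷_)
open import Function using (_⇔_; mk⇔; Equivalence)
open import Function.Construct.Composition using (_⇔-∘_)
open import Function.Construct.Symmetry using (⇔-sym)
open import Relation.Nullary using (¬_; Dec; yes; no)
open import Relation.Nullary.Decidable using (_×-dec_; map′; dec-true; dec-false)
open import Relation.Nullary.Decidable.Core using (T?)
open import Relation.Binary.PropositionalEquality
  using (_≡_; _≢_; refl; sym; trans; cong; subst; subst₂; module ≡-Reasoning)

open Equivalence using (to; from)

true≢false : true ≢ false
true≢false ()

false≢true : false ≢ true
false≢true ()

split-last : ∀ {n} (C : Vec Bool (suc n)) → C ≡ init C ∷ʳ last C
split-last C = proj₂ (proj₂ (initLast C))

split-last≡ : ∀ {n} (C : Vec Bool (suc n)) {b} → last C ≡ b → C ≡ init C ∷ʳ b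
split-last≡ C refl = split-last C

init-∷ʳ≡ : ∀ {n} {C : Vec Bool (suc n)} {τ b} → C ≡ τ ∷ʳ b → init C ≡ τ
init-∷ʳ≡ {τ = τ} {b} refl = init-∷ʳ b τ

last-∷ʳ≡ : ∀ {n} {C : Vec Bool (suc n)} {τ b} → C ≡ τ ∷ʳ b → last C ≡ b
last-∷ʳ≡ {τ = τ} {b} refl = last-∷ʳ b τ

≡-∷ʳ : ∀ {n} {C : Vec Bool (suc n)} {τ b} → init C ≡ τ → last C ≡ b → C ≡ τ ∷ʳ b
≡-∷ʳ {C = C} refl refl = split-last C

pre-∷ʳ : ∀ {n} j (C : Vec Bool n) b → j ≤ n → pre j (C ∷ʳ b) ≡ pre j C
pre-∷ʳ zero    C           b _         = refl
pre-∷ʳ (suc j) (true ∷ C)  b (s≤s j≤n) = cong suc (pre-∷ʳ j C b j≤n)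
pre-∷ʳ (suc j) (false ∷ C) b (s≤s j≤n) = pre-∷ʳ j C b j≤n

pre-length : ∀ {n} (C : Vec Bool n) → pre n C ≡ countE C
pre-length []          = refl
pre-length (true ∷ C)  = cong suc (pre-length C)
pre-length (false ∷ C) = pre-length C

countE-∷ʳ-false : ∀ {n} (C : Vec Bool n) → countE (C ∷ʳ false) ≡ countE C
countE-∷ʳ-false []          = refl
countE-∷ʳ-false (true ∷ C)  = cong suc (countE-∷ʳ-false C)
countE-∷ʳ-false (false ∷ C) = countE-∷ʳ-false C

countE-∷ʳ-true : ∀ {n} (C : Vec Bool n) → countE (C ∷ʳ true) ≡ suc (countE C)
countE-∷ʳ-true []          = refl
countE-∷ʳ-true (true ∷ C)  = cong suc (countE-∷ʳ-true C)
countE-∷ʳ-true (false ∷ C) = countE-∷ʳ-true C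

pre-≤-pre-suc : ∀ {n} t (B : Vec Bool n) → pre t B ≤ pre (suc t) B
pre-≤-pre-suc zero    B           = z≤n
pre-≤-pre-suc (suc t) []          = z≤n
pre-≤-pre-suc (suc t) (true ∷ B)  = s≤s (pre-≤-pre-suc t B)
pre-≤-pre-suc (suc t) (false ∷ B) = pre-≤-pre-suc t B

pre-suc-≤ : ∀ {n} t (B : Vec Bool n) → pre (suc t) B ≤ suc (pre t B)
pre-suc-≤ t       []          = z≤n
pre-suc-≤ zero    (true ∷ B)  = ≤-refl
pre-suc-≤ zero    (false ∷ B) = z≤n
pre-suc-≤ (suc t) (true ∷ B)  = s≤s (pre-suc-≤ t B)
pre-suc-≤ (suc t) (false ∷ B) = pre-suc-≤ t B

pre-suc-true : ∀ {n} (B : Vec Bool n) j → lookup B j ≡ true → pre (suc (toℕ j)) B ≡ suc (pre (toℕ j) B)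
pre-suc-true (true ∷ B)  zero    _  = refl
pre-suc-true (true ∷ B)  (suc j) Bj = cong suc (pre-suc-true B j Bj)
pre-suc-true (false ∷ B) (suc j) Bj = pre-suc-true B j Bj

pre-suc-false : ∀ {n} (B : Vec Bool n) j → lookup B j ≡ false → pre (suc (toℕ j)) B ≡ pre (toℕ j) B
pre-suc-false (false ∷ B) zero    _  = refl
pre-suc-false (true ∷ B)  (suc j) Bj = cong suc (pre-suc-false B j Bj)
pre-suc-false (false ∷ B) (suc j) Bj = pre-suc-false B j Bj

pre-update-≤ : ∀ {n} (B : Vec Bool n) i b t → t ≤ toℕ i → pre t (B [ i ]≔ b) ≡ pre t B
pre-update-≤ B           i       b zero    _         = refl
pre-update-≤ (true ∷ B)  (suc i) b (suc t) (s≤s t≤i) = cong suc (pre-update-≤ B i b t t≤i)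
pre-update-≤ (false ∷ B) (suc i) b (suc t) (s≤s t≤i) = pre-update-≤ B i b t t≤i

pre-remove : ∀ {n} (B : Vec Bool n) i t → toℕ i < t → lookup B i ≡ true →
             suc (pre t (B [ i ]≔ false)) ≡ pre t B
pre-remove (true ∷ B)  zero    (suc t) _         refl = refl
pre-remove (true ∷ B)  (suc i) (suc t) (s≤s i<t) Bi   = cong suc (pre-remove B i t i<t Bi)
pre-remove (false ∷ B) (suc i) (suc t) (s≤s i<t) Bi   = pre-remove B i t i<t Bi

pre-insert : ∀ {n} (B : Vec Bool n) i t → toℕ i < t → lookup B i ≡ false →
             pre t (B [ i ]≔ true) ≡ suc (pre t B)
pre-insert (false ∷ B) zero    (suc t) _         refl = refl
pre-insert (true ∷ B)  (suc i) (suc t) (s≤s i<t) Bi   = cong suc (pre-insert B i t i<t Bi)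
pre-insert (false ∷ B) (suc i) (suc t) (s≤s i<t) Bi   = pre-insert B i t i<t Bi

-- 𝒫[U,L] is the region with u = pre · U and l = pre · L; induction on n needs arbitrary bounds.
Bounded : (n : ℕ) (u l : ℕ → ℕ) → Vec Bool n → Set
Bounded n u l C = ∀ j → j ≤ n → u j ≤ pre j C × pre j C ≤ l j

InRegion : (n d : ℕ) (u l : ℕ → ℕ) → Vec Bool n → Set
InRegion n d u l C = countE C ≡ d × Bounded n u l C

bounded-∷ʳ⁻ : ∀ {n u l} (C : Vec Bool n) b → Bounded (suc n) u l (C ∷ʳ b) → Bounded n u l C
bounded-∷ʳ⁻ C b bnd j j≤n =
  subst (λ p → _ ≤ p × p ≤ _) (pre-∷ʳ j C b j≤n) (bnd j (m≤n⇒m≤1+n j≤n))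

bounded-∷ʳ⁺ : ∀ {n u l} (C : Vec Bool n) b → Bounded n u l C →
  u (suc n) ≤ pre (suc n) (C ∷ʳ b) → pre (suc n) (C ∷ʳ b) ≤ l (suc n) → Bounded (suc n) u l (C ∷ʳ b)
bounded-∷ʳ⁺ C b bnd lo hi j j≤1+n with m≤n⇒m<n∨m≡n j≤1+n
... | inj₁ (s≤s j≤n) = subst (λ p → _ ≤ p × p ≤ _) (sym (pre-∷ʳ j C b j≤n)) (bnd j j≤n)
... | inj₂ refl      = lo , hi

inRegion-endpoint : ∀ {n d u l} (C : Vec Bool n) → InRegion n d u l C → u n ≤ d × d ≤ l n
inRegion-endpoint {n} C (refl , bnd) = subst (λ p → _ ≤ p × p ≤ _) (pre-length C) (bnd n ≤-refl)

inRegion-∷ʳ-false⁻ : ∀ {n d u l} (C : Vec Bool n) → InRegion (suc n) d u l (C ∷ʳ false) → InRegion n d u l C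
inRegion-∷ʳ-false⁻ C (cnt , bnd) = trans (sym (countE-∷ʳ-false C)) cnt , bounded-∷ʳ⁻ C false bnd

inRegion-∷ʳ-true⁻ : ∀ {n d u l} (C : Vec Bool n) → InRegion (suc n) d u l (C ∷ʳ true) →
                    Σ ℕ λ d′ → d ≡ suc d′ × InRegion n d′ u l C
inRegion-∷ʳ-true⁻ C (cnt , bnd) = countE C , trans (sym cnt) (countE-∷ʳ-true C) , refl , bounded-∷ʳ⁻ C true bnd

inRegion-∷ʳ⁺ : ∀ {n d u l} (C : Vec Bool n) b → Bounded n u l C → countE (C ∷ʳ b) ≡ d →
               u (suc n) ≤ d → d ≤ l (suc n) → InRegion (suc n) d u l (C ∷ʳ b)
inRegion-∷ʳ⁺ C b bnd refl lo hi =
  refl , bounded-∷ʳ⁺ C b bnd (subst (_ ≤_) (sym (pre-length (C ∷ʳ b))) lo)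
                             (subst (_≤ _) (sym (pre-length (C ∷ʳ b))) hi)

inRegion-∷ʳ-false⁺ : ∀ {n d u l} (C : Vec Bool n) → InRegion n d u l C →
                     u (suc n) ≤ d → d ≤ l (suc n) → InRegion (suc n) d u l (C ∷ʳ false)
inRegion-∷ʳ-false⁺ C (refl , bnd) = inRegion-∷ʳ⁺ C false bnd (countE-∷ʳ-false C)

inRegion-∷ʳ-true⁺ : ∀ {n d u l} (C : Vec Bool n) → InRegion n d u l C →
                    u (suc n) ≤ suc d → suc d ≤ l (suc n) → InRegion (suc n) (suc d) u l (C ∷ʳ true)
inRegion-∷ʳ-true⁺ C (refl , bnd) = inRegion-∷ʳ⁺ C true bnd (countE-∷ʳ-true C)

below-suc : ∀ {P : ℕ → Set} {n} → (∀ j → j ≤ suc n → P j) → ∀ j → j ≤ n → P j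
below-suc P≤1+n j j≤n = P≤1+n j (m≤n⇒m≤1+n j≤n)

inRegion-antitoneᵘ : ∀ {n d u u′ l} → (∀ j → j ≤ n → u j ≤ u′ j) →
                     ∀ C → InRegion n d u′ l C → InRegion n d u l C
inRegion-antitoneᵘ u≤u′ C (cnt , bnd) =
  cnt , λ j j≤n → ≤-trans (u≤u′ j j≤n) (proj₁ (bnd j j≤n)) , proj₂ (bnd j j≤n)

inRegion? : ∀ n d u l (C : Vec Bool n) → Dec (InRegion n d u l C)
inRegion? n d u l C = (countE C ≟ d) ×-dec bounded?
  where
  bounded? : Dec (Bounded n u l C)
  bounded? = map′ (λ h j j≤n → h (s≤s j≤n)) (λ h {j} j<1+n → h j (≤-pred j<1+n))
                  (allUpTo? (λ j → (u j ≤? pre j C) ×-dec (pre j C ≤? l j)) (suc n))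

∈-allSubs : ∀ {n} (C : Vec Bool n) → C ∈ allSubs n
∈-allSubs []                  = here refl
∈-allSubs {suc n} (false ∷ C) = ∈-++⁺ˡ (∈-map⁺ (false ∷_) (∈-allSubs C))
∈-allSubs {suc n} (true ∷ C)  = ∈-++⁺ʳ (mapL (false ∷_) (allSubs n)) (∈-map⁺ (true ∷_) (∈-allSubs C))

Represents : ∀ {k} → List (Sub k) → (Sub k → Set) → Set
Represents Bs P = ∀ C → C ∈ Bs ⇔ P C

regionBases : ∀ n d (u l : ℕ → ℕ) → List (Sub n)
regionBases n d u l = filter (inRegion? n d u l) (allSubs n)

regionBases-represents : ∀ n d u l → Represents (regionBases n d u l) (InRegion n d u l)
regionBases-represents n d u l C =
  mk⇔ (λ C∈ → proj₂ (∈-filter⁻ (inRegion? n d u l) {xs = allSubs n} C∈))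
      (∈-filter⁺ (inRegion? n d u l) (∈-allSubs C))

module _ {Q : ℕ → Set} (Q? : ∀ t → Dec (Q t)) where

  first-exit : ∀ {a b} → a ≤ b → Q a → ¬ Q b →
               Σ ℕ λ j → a ≤ j × j < b × ¬ Q (suc j) × (∀ t → a ≤ t → t ≤ j → Q t)
  first-exit {a} {b} a≤b = search (b ∸ a) a (m∸n+n≡m a≤b)
    where
    search : ∀ k a → k + a ≡ b → Q a → ¬ Q b →
             Σ ℕ λ j → a ≤ j × j < b × ¬ Q (suc j) × (∀ t → a ≤ t → t ≤ j → Q t)
    search zero    a refl  Qa ¬Qb = ⊥-elim (¬Qb Qa)
    search (suc k) a k+a≡b Qa ¬Qb with Q? (suc a)
    ... | no ¬Q[1+a] = a , ≤-refl , subst (a <_) k+a≡b (s≤s (m≤n+m a k)) , ¬Q[1+a] ,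
                       λ t a≤t t≤a → subst Q (≤-antisym a≤t t≤a) Qa
    ... | yes Q[1+a] with search k (suc a) (trans (+-suc k a) k+a≡b) Q[1+a] ¬Qb
    ...   | j , a<j , j<b , ¬Q[1+j] , Q-on = j , ≤-trans (n≤1+n a) a<j , j<b , ¬Q[1+j] , Q-on′
      where
      Q-on′ : ∀ t → a ≤ t → t ≤ j → Q t
      Q-on′ t a≤t t≤j with m≤n⇒m<n∨m≡n a≤t
      ... | inj₁ a<t  = Q-on t a<t t≤j
      ... | inj₂ refl = Qa

  last-entry : ∀ k → ¬ Q 0 → Q k → Σ ℕ λ j → j < k × ¬ Q j × (∀ t → j < t → t ≤ k → Q t)
  last-entry zero    ¬Q0 Q0     = ⊥-elim (¬Q0 Q0)
  last-entry (suc k) ¬Q0 Q[1+k] with Q? k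
  ... | no ¬Qk = k , ≤-refl , ¬Qk , λ t k<t t≤1+k → subst Q (≤-antisym k<t t≤1+k) Q[1+k]
  ... | yes Qk with last-entry k ¬Q0 Qk
  ...   | j , j<k , ¬Qj , Q-on = j , m≤n⇒m≤1+n j<k , ¬Qj , Q-on′
    where
    Q-on′ : ∀ t → j < t → t ≤ suc k → Q t
    Q-on′ t j<t t≤1+k with m≤n⇒m<n∨m≡n t≤1+k
    ... | inj₁ (s≤s t≤k) = Q-on t j<t t≤k
    ... | inj₂ refl      = Q[1+k]

Between : ℕ → ℕ → ℕ → Set
Between a b c = (a ≤ c × c ≤ b) ⊎ (b ≤ c × c ≤ a)

between-≡ : ∀ {a b c} → c ≡ a → Between a b c
between-≡ {a} {b} refl with ≤-total a b
... | inj₁ a≤b = inj₁ (≤-refl , a≤b)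
... | inj₂ b≤a = inj₂ (b≤a , ≤-refl)

bounded-between : ∀ {n u l} (B₁ B₂ V : Vec Bool n) → Bounded n u l B₁ → Bounded n u l B₂ →
                  (∀ t → t ≤ n → Between (pre t B₁) (pre t B₂) (pre t V)) → Bounded n u l V
bounded-between B₁ B₂ V bnd₁ bnd₂ btw t t≤n with btw t t≤n | bnd₁ t t≤n | bnd₂ t t≤n
... | inj₁ (lo , hi) | u≤B₁ , _ | _ , B₂≤l = ≤-trans u≤B₁ lo , ≤-trans hi B₂≤l
... | inj₂ (lo , hi) | _ , B₁≤l | u≤B₂ , _ = ≤-trans u≤B₂ lo , ≤-trans hi B₁≤l

swap : ∀ {n} → Vec Bool n → Fin n → Fin n → Vec Bool n
swap B i j = (B [ i ]≔ false) [ j ]≔ true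

module Swap {n} (B : Vec Bool n) (i j : Fin n) (Bi : lookup B i ≡ true) (Bj : lookup B j ≡ false) where

  private
    removed-j : lookup (B [ i ]≔ false) j ≡ false
    removed-j = trans (lookup∘update′ j≢i B false) Bj
      where
      j≢i : j ≢ i
      j≢i refl with trans (sym Bi) Bj
      ... | ()

  pre-swap-below : ∀ t → t ≤ toℕ i → t ≤ toℕ j → pre t (swap B i j) ≡ pre t B
  pre-swap-below t t≤i t≤j = trans (pre-update-≤ _ j true t t≤j) (pre-update-≤ B i false t t≤i)

  pre-swap-above : ∀ t → toℕ i < t → toℕ j < t → pre t (swap B i j) ≡ pre t B
  pre-swap-above t i<t j<t = trans (pre-insert _ j t j<t removed-j) (pre-remove B i t i<t Bi)

  pre-swap-dip : ∀ t → toℕ i < t → t ≤ toℕ j → suc (pre t (swap B i j)) ≡ pre t B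
  pre-swap-dip t i<t t≤j = trans (cong suc (pre-update-≤ _ j true t t≤j)) (pre-remove B i t i<t Bi)

  pre-swap-bump : ∀ t → toℕ j < t → t ≤ toℕ i → pre t (swap B i j) ≡ suc (pre t B)
  pre-swap-bump t j<t t≤i = trans (pre-insert _ j t j<t removed-j) (cong suc (pre-update-≤ B i false t t≤i))

  countE-swap : countE (swap B i j) ≡ countE B
  countE-swap = trans (sym (pre-length (swap B i j))) (trans (pre-swap-above n (toℕ<n i) (toℕ<n j)) (pre-length B))

leaves-above : ∀ {n} (B₁ B₂ : Vec Bool n) j →
  pre (toℕ j) B₂ < pre (toℕ j) B₁ → ¬ (pre (suc (toℕ j)) B₂ < pre (suc (toℕ j)) B₁) →
  lookup B₁ j ≡ false × lookup B₂ j ≡ true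
leaves-above B₁ B₂ j ahead ¬ahead′ = B₁j , B₂j
  where
  B₁j : lookup B₁ j ≡ false
  B₁j with lookup B₁ j in eq
  ... | false = refl
  ... | true  = ⊥-elim (¬ahead′ (subst (_ <_) (sym (pre-suc-true B₁ j eq))
                                   (s≤s (≤-trans (pre-suc-≤ (toℕ j) B₂) ahead))))
  B₂j : lookup B₂ j ≡ true
  B₂j with lookup B₂ j in eq
  ... | true  = refl
  ... | false = ⊥-elim (¬ahead′ (subst (_< _) (sym (pre-suc-false B₂ j eq))
                                   (<-≤-trans ahead (pre-≤-pre-suc (toℕ j) B₁))))

enters-below : ∀ {n} (B₁ B₂ : Vec Bool n) j →
  ¬ (pre (toℕ j) B₁ < pre (toℕ j) B₂) → pre (suc (toℕ j)) B₁ < pre (suc (toℕ j)) B₂ →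
  lookup B₁ j ≡ false × lookup B₂ j ≡ true
enters-below B₁ B₂ j ¬behind behind′ = B₁j , B₂j
  where
  B₁j : lookup B₁ j ≡ false
  B₁j with lookup B₁ j in eq
  ... | false = refl
  ... | true  = ⊥-elim (¬behind (≤-pred (≤-trans (subst (λ p → suc p ≤ _) (pre-suc-true B₁ j eq) behind′)
                                                   (pre-suc-≤ (toℕ j) B₂))))
  B₂j : lookup B₂ j ≡ true
  B₂j with lookup B₂ j in eq
  ... | true  = refl
  ... | false = ⊥-elim (<-irrefl refl (<-≤-trans behind′ (≤-trans (≤-reflexive (pre-suc-false B₂ j eq))
                                         (≤-trans (≮⇒≥ ¬behind) (pre-≤-pre-suc (toℕ j) B₁)))))

Exchange : ∀ {n} → (Vec Bool n → Set) → Vec Bool n → Vec Bool n → Fin n → Set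
Exchange {n} P B₁ B₂ i = Σ (Fin n) λ j → lookup B₂ j ≡ true × ¬ lookup B₁ j ≡ true × P (swap B₁ i j)

swap-inRegion : ∀ {n d u l} (B₁ B₂ : Vec Bool n) → InRegion n d u l B₁ → InRegion n d u l B₂ →
  ∀ i j (B₁i : lookup B₁ i ≡ true) (B₁j : lookup B₁ j ≡ false) →
  (∀ t → t ≤ n → Between (pre t B₁) (pre t B₂) (pre t (swap B₁ i j))) → InRegion n d u l (swap B₁ i j)
swap-inRegion B₁ B₂ (cnt₁ , bnd₁) (_ , bnd₂) i j B₁i B₁j btw =
  trans (Swap.countE-swap B₁ i j B₁i B₁j) cnt₁ , bounded-between B₁ B₂ _ bnd₁ bnd₂ btw

exchange-witness : ∀ {n d u l} (B₁ B₂ : Vec Bool n) → InRegion n d u l B₁ → InRegion n d u l B₂ →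
  ∀ i j → lookup B₁ i ≡ true → lookup B₁ j ≡ false → lookup B₂ j ≡ true →
  (∀ t → t ≤ n → Between (pre t B₁) (pre t B₂) (pre t (swap B₁ i j))) → Exchange (InRegion n d u l) B₁ B₂ i
exchange-witness B₁ B₂ r₁ r₂ i j B₁i B₁j B₂j btw =
  j , B₂j , (λ B₁j′ → false≢true (trans (sym B₁j) B₁j′)) , swap-inRegion B₁ B₂ r₁ r₂ i j B₁i B₁j btw

pre-end : ∀ {n d u l} (B₁ B₂ : Vec Bool n) → InRegion n d u l B₁ → InRegion n d u l B₂ → pre n B₁ ≡ pre n B₂
pre-end B₁ B₂ (cnt₁ , _) (cnt₂ , _) = trans (pre-length B₁) (trans cnt₁ (sym (trans (pre-length B₂) cnt₂)))

-- j is the first point after i where B₂ catches up with B₁; on (i, j] the path B₁ is strictly ahead,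
-- so moving its e from i to j keeps it between B₁ and B₂.
exchange-forward : ∀ {n d u l} (B₁ B₂ : Vec Bool n) → InRegion n d u l B₁ → InRegion n d u l B₂ →
  ∀ i → lookup B₁ i ≡ true → pre (suc (toℕ i)) B₂ < pre (suc (toℕ i)) B₁ → Exchange (InRegion n d u l) B₁ B₂ i
exchange-forward {n} B₁ B₂ r₁ r₂ i B₁i ahead
  with first-exit (λ t → pre t B₂ <? pre t B₁) (toℕ<n i) ahead
                  (λ lt → <-irrefl (pre-end B₂ B₁ r₂ r₁) lt)
... | j , i<j , j<n , ¬ahead′ , ahead-on with fromℕ< j<n | toℕ-fromℕ< j<n
... | jF | refl = exchange-witness B₁ B₂ r₁ r₂ i jF B₁i B₁j B₂j btw
  where
  crossing : lookup B₁ jF ≡ false × lookup B₂ jF ≡ true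
  crossing = leaves-above B₁ B₂ jF (ahead-on (toℕ jF) i<j ≤-refl) ¬ahead′
  B₁j : lookup B₁ jF ≡ false
  B₁j = proj₁ crossing
  B₂j : lookup B₂ jF ≡ true
  B₂j = proj₂ crossing
  open Swap B₁ i jF B₁i B₁j
  btw : ∀ t → t ≤ n → Between (pre t B₁) (pre t B₂) (pre t (swap B₁ i jF))
  btw t _ with t ≤? toℕ i | t ≤? toℕ jF
  ... | yes t≤i | _       = between-≡ (pre-swap-below t t≤i (≤-trans t≤i (<⇒≤ i<j)))
  ... | no t≰i  | no t≰j  = between-≡ (pre-swap-above t (≰⇒> t≰i) (≰⇒> t≰j))
  ... | no t≰i  | yes t≤j =
    inj₂ (≤-pred (subst (_ ≤_) (sym dip) (ahead-on t (≰⇒> t≰i) t≤j)) , ≤-trans (n≤1+n _) (≤-reflexive dip))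
    where
    dip : suc (pre t (swap B₁ i jF)) ≡ pre t B₁
    dip = pre-swap-dip t (≰⇒> t≰i) t≤j

-- Mirror image: j is the last point before i from which on B₁ is strictly behind B₂.
exchange-backward : ∀ {n d u l} (B₁ B₂ : Vec Bool n) → InRegion n d u l B₁ → InRegion n d u l B₂ →
  ∀ i → lookup B₁ i ≡ true → lookup B₂ i ≡ false → ¬ (pre (suc (toℕ i)) B₂ < pre (suc (toℕ i)) B₁) →
  Exchange (InRegion n d u l) B₁ B₂ i
exchange-backward {n} B₁ B₂ r₁ r₂ i B₁i B₂i ¬ahead
  with last-entry (λ t → pre t B₁ <? pre t B₂) (toℕ i) (λ ()) behind-at-i
  where
  behind-at-i : pre (toℕ i) B₁ < pre (toℕ i) B₂
  behind-at-i = subst₂ _≤_ (pre-suc-true B₁ i B₁i) (pre-suc-false B₂ i B₂i) (≮⇒≥ ¬ahead)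
... | j , j<i , ¬behind , behind-on with fromℕ< (<-trans j<i (toℕ<n i)) | toℕ-fromℕ< (<-trans j<i (toℕ<n i))
... | jF | refl = exchange-witness B₁ B₂ r₁ r₂ i jF B₁i B₁j B₂j btw
  where
  crossing : lookup B₁ jF ≡ false × lookup B₂ jF ≡ true
  crossing = enters-below B₁ B₂ jF ¬behind (behind-on (suc (toℕ jF)) ≤-refl j<i)
  B₁j : lookup B₁ jF ≡ false
  B₁j = proj₁ crossing
  B₂j : lookup B₂ jF ≡ true
  B₂j = proj₂ crossing
  open Swap B₁ i jF B₁i B₁j
  btw : ∀ t → t ≤ n → Between (pre t B₁) (pre t B₂) (pre t (swap B₁ i jF))
  btw t _ with t ≤? toℕ jF | t ≤? toℕ i
  ... | yes t≤j | _       = between-≡ (pre-swap-below t (≤-trans t≤j (<⇒≤ j<i)) t≤j)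
  ... | no t≰j  | no t≰i  = between-≡ (pre-swap-above t (≰⇒> t≰i) (≰⇒> t≰j))
  ... | no t≰j  | yes t≤i =
    inj₁ (≤-trans (n≤1+n _) (≤-reflexive (sym bump)) , subst (_≤ _) (sym bump) (behind-on t (≰⇒> t≰j) t≤i))
    where
    bump : pre t (swap B₁ i jF) ≡ suc (pre t B₁)
    bump = pre-swap-bump t (≰⇒> t≰j) t≤i

exchange : ∀ {n d u l} (B₁ B₂ : Vec Bool n) → InRegion n d u l B₁ → InRegion n d u l B₂ →
  ∀ i → lookup B₁ i ≡ true → ¬ lookup B₂ i ≡ true → Exchange (InRegion n d u l) B₁ B₂ i
exchange B₁ B₂ r₁ r₂ i B₁i B₂i with pre (suc (toℕ i)) B₂ <? pre (suc (toℕ i)) B₁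
... | yes ahead = exchange-forward B₁ B₂ r₁ r₂ i B₁i ahead
... | no ¬ahead = exchange-backward B₁ B₂ r₁ r₂ i B₁i (¬-not B₂i) ¬ahead

regionMatroid : ∀ {n d u l} (Bs : List (Sub n)) → Represents Bs (InRegion n d u l) → (∃ λ B → B ∈ Bs) → IsMatroid Bs
regionMatroid Bs rep nonempty = record
  { nonempty = nonempty
  ; exchange = λ B₁ B₂ B₁∈ B₂∈ i B₁i B₂i →
      let (j , B₂j , B₁j , r) = exchange B₁ B₂ (to (rep B₁) B₁∈) (to (rep B₂) B₂∈) i B₁i B₂i
      in j , B₂j , B₁j , from (rep _) r
  }

Slex-antitone : ∀ {k} {Bs Bs′ : List (Sub k)} → (∀ C → C ∈ Bs′ → C ∈ Bs) → ∀ τ → Slex Bs′ τ → Slex Bs τ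
Slex-antitone Bs′⊆Bs τ τ∈S (f , a , vanishes , leading , a≤τ) =
  τ∈S (f , a , (λ B B∈ → vanishes B (Bs′⊆Bs B B∈)) , leading , a≤τ)

Slex-represents : ∀ {k} {P : Sub k → Set} {Bs Bs′ : List (Sub k)} →
                  Represents Bs P → Represents Bs′ P → ∀ τ → Slex Bs τ → Slex Bs′ τ
Slex-represents rep rep′ = Slex-antitone (λ C C∈ → from (rep′ C) (to (rep C) C∈))

Slex-∷ʳ-true⇒false : ∀ {n} (Bs : List (Sub (suc n))) τ → Slex Bs (τ ∷ʳ true) → Slex Bs (τ ∷ʳ false)
Slex-∷ʳ-true⇒false Bs τ τ∈S (f , a , vanishes , leading , a≤τ) =
  τ∈S (f , a , vanishes , leading , weaken a τ a≤τ)
  where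
  weaken : ∀ {n} (a : Mono (suc n)) (τ : Vec Bool n) →
           Pointwise _≤_ a (sqfree (τ ∷ʳ false)) → Pointwise _≤_ a (sqfree (τ ∷ʳ true))
  weaken (_ ∷ []) []      (z≤n ∷ []) = z≤n ∷ []
  weaken (_ ∷ a)  (_ ∷ τ) (p ∷ ps)   = p ∷ weaken a τ ps

≻lex-irrefl : ∀ {k} (a : Mono k) → ¬ (a ≻lex a)
≻lex-irrefl (x ∷ a) (here x>x) = <-irrefl refl x>x
≻lex-irrefl (x ∷ a) (there a≻a) = ≻lex-irrefl a a≻a

-- The constant polynomial 1 vanishes on the empty V_M and has leading monomial 1.
Slex-nonempty : ∀ {k} (Bs : List (Sub k)) τ → Slex Bs τ → ∃ λ B → B ∈ Bs
Slex-nonempty (B ∷ _) τ _ = B , here refl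
Slex-nonempty {k} [] τ τ∈S = ⊥-elim (τ∈S (one , 𝟙 , (λ _ ()) , (one≢0 , one-leading) , zero≤ τ))
  where
  𝟙 : Mono k
  𝟙 = replicate k 0
  one : Poly k
  one = (1ℚ , 𝟙) ∷ []
  one≢0 : coeff one 𝟙 ≢ 0ℚ
  one≢0 rewrite dec-true (≡-dec _≟_ 𝟙 𝟙) refl | +-identityʳ 1ℚ = λ ()
  one-leading : ∀ b → b ≻lex 𝟙 → coeff one b ≡ 0ℚ
  one-leading b b≻𝟙
    rewrite dec-false (≡-dec _≟_ 𝟙 b) (λ 𝟙≡b → ≻lex-irrefl b (subst (b ≻lex_) 𝟙≡b b≻𝟙)) = refl
  zero≤ : ∀ {k} (τ : Sub k) → Pointwise _≤_ (replicate k 0) (sqfree τ)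
  zero≤ []      = []
  zero≤ (_ ∷ τ) = z≤n ∷ zero≤ τ

any≡false : ∀ {A : Set} (p : A → Bool) (xs : List A) → any p xs ≡ false → ∀ x → x ∈ xs → p x ≡ false
any≡false p (y ∷ xs) _ x (here refl) with p y
... | false = refl
any≡false p (y ∷ xs) any≡f x (there x∈) with p y
... | false = any≡false p xs any≡f x x∈

∈-init-filter : ∀ {n} (p : Sub (suc n) → Bool) b → (∀ B → T (p B) ⇔ last B ≡ b) →
                (Bs : List (Sub (suc n))) → ∀ C → C ∈ mapL init (filterᵇ p Bs) ⇔ C ∷ʳ b ∈ Bs
∈-init-filter p b p⇔ Bs C = mk⇔ to′ from′
  where
  to′ : C ∈ mapL init (filterᵇ p Bs) → C ∷ʳ b ∈ Bs
  to′ C∈ with ∈-map⁻ init C∈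
  ... | B , B∈ , refl with ∈-filter⁻ (λ B → T? (p B)) {xs = Bs} B∈
  ...   | B∈Bs , pB = subst (_∈ Bs) (split-last≡ B (to (p⇔ B) pB)) B∈Bs
  from′ : C ∷ʳ b ∈ Bs → C ∈ mapL init (filterᵇ p Bs)
  from′ C∈ = subst (_∈ _) (init-∷ʳ b C)
               (∈-map⁺ init (∈-filter⁺ (λ B → T? (p B)) C∈ (from (p⇔ (C ∷ʳ b)) (last-∷ʳ b C))))

T-not-≡ : ∀ {b} → T (not b) ⇔ b ≡ false
T-not-≡ {false} = mk⇔ (λ _ → refl) (λ _ → tt)
T-not-≡ {true}  = mk⇔ (λ ()) (λ ())

∈-deleteLast : ∀ {n} (Bs : List (Sub (suc n))) B → B ∈ Bs → last B ≡ false →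
               ∀ C → C ∈ deleteLast Bs ⇔ C ∷ʳ false ∈ Bs
∈-deleteLast Bs B B∈ lastB C with any (λ B → not (last B)) Bs in eq
... | true  = ∈-init-filter (λ B → not (last B)) false (λ B → T-not-≡) Bs C
... | false = ⊥-elim (true≢false (trans (sym (cong not lastB)) (any≡false _ Bs eq B B∈)))

∈-contractLast : ∀ {n} (Bs : List (Sub (suc n))) B → B ∈ Bs → last B ≡ true →
                 ∀ C → C ∈ contractLast Bs ⇔ C ∷ʳ true ∈ Bs
∈-contractLast Bs B B∈ lastB C with any last Bs in eq
... | true  = ∈-init-filter last true (λ B → T-≡) Bs C
... | false = ⊥-elim (true≢false (trans (sym lastB) (any≡false _ Bs eq B B∈)))

init∈deleteLast : ∀ {n} (Bs : List (Sub (suc n))) B → B ∈ Bs → last B ≡ false → init B ∈ deleteLast Bs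
init∈deleteLast Bs B B∈ lastB =
  from (∈-deleteLast Bs B B∈ lastB (init B)) (subst (_∈ Bs) (split-last≡ B lastB) B∈)

init∈contractLast : ∀ {n} (Bs : List (Sub (suc n))) B → B ∈ Bs → last B ≡ true → init B ∈ contractLast Bs
init∈contractLast Bs B B∈ lastB =
  from (∈-contractLast Bs B B∈ lastB (init B)) (subst (_∈ Bs) (split-last≡ B lastB) B∈)

deleteLast-represents : ∀ {n d u l} (Bs : List (Sub (suc n))) → Represents Bs (InRegion (suc n) d u l) →
  ∀ B → B ∈ Bs → last B ≡ false → Represents (deleteLast Bs) (InRegion n d u l)
deleteLast-represents {n} {d} {u} {l} Bs rep B B∈ lastB C =
  mk⇔ (λ C∈ → inRegion-∷ʳ-false⁻ C (to (rep _) (to (∈-deleteLast Bs B B∈ lastB C) C∈)))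
      (λ r → from (∈-deleteLast Bs B B∈ lastB C)
                  (from (rep _) (inRegion-∷ʳ-false⁺ C r (proj₁ endpoint) (proj₂ endpoint))))
  where
  endpoint : u (suc n) ≤ d × d ≤ l (suc n)
  endpoint = inRegion-endpoint B (to (rep B) B∈)

contractLast-represents : ∀ {n d u l} (Bs : List (Sub (suc n))) → Represents Bs (InRegion (suc n) d u l) →
  ∀ B → B ∈ Bs → last B ≡ true → Σ ℕ λ d′ → d ≡ suc d′ × Represents (contractLast Bs) (InRegion n d′ u l)
contractLast-represents {n} {d} {u} {l} Bs rep B B∈ lastB
  with inRegion-∷ʳ-true⁻ (init B) (subst (λ B → InRegion (suc n) d u l B) (split-last≡ B lastB) (to (rep B) B∈))
... | d′ , refl , _ = d′ , refl , λ C → mk⇔ (to′ C) (from′ C)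
  where
  ∈K : ∀ C → C ∈ contractLast Bs ⇔ C ∷ʳ true ∈ Bs
  ∈K = ∈-contractLast Bs B B∈ lastB
  endpoint : u (suc n) ≤ suc d′ × suc d′ ≤ l (suc n)
  endpoint = inRegion-endpoint B (to (rep B) B∈)
  to′ : ∀ C → C ∈ contractLast Bs → InRegion n d′ u l C
  to′ C C∈ with inRegion-∷ʳ-true⁻ C (to (rep _) (to (∈K C) C∈))
  ... | _ , refl , r = r
  from′ : ∀ C → InRegion n d′ u l C → C ∈ contractLast Bs
  from′ C r = from (∈K C) (from (rep _) (inRegion-∷ʳ-true⁺ C r (proj₁ endpoint) (proj₂ endpoint)))

Face : ∀ n (d : ℕ) (u l : ℕ → ℕ) → Sub n → Set
Face n d u l = Slex (regionBases n d u l)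

-- Faces of the region with one e fewer; d ∸ 1 would wrongly identify d = 0 with d = 1.
PredFace : ∀ n (d : ℕ) (u l : ℕ → ℕ) → Sub n → Set
PredFace n zero    u l τ = ⊥
PredFace n (suc d) u l τ = Face n d u l τ

Slex⇔Face : ∀ {n d u l} {Bs : List (Sub n)} → Represents Bs (InRegion n d u l) → ∀ τ → Slex Bs τ ⇔ Face n d u l τ
Slex⇔Face {n} {d} {u} {l} rep τ =
  mk⇔ (Slex-represents rep (regionBases-represents n d u l) τ) (Slex-represents (regionBases-represents n d u l) rep τ)

Face-nonempty : ∀ {n d u l} τ → Face n d u l τ → ∃ (InRegion n d u l)
Face-nonempty {n} {d} {u} {l} τ τ∈S =
  let (C , C∈) = Slex-nonempty (regionBases n d u l) τ τ∈S in C , to (regionBases-represents n d u l C) C∈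

Face-antitoneᵘ : ∀ {n d u u′ l} → (∀ j → j ≤ n → u j ≤ u′ j) → ∀ τ → Face n d u′ l τ → Face n d u l τ
Face-antitoneᵘ {n} {d} {u} {u′} {l} u≤u′ = Slex-antitone λ C C∈ →
  from (regionBases-represents n d u l C) (inRegion-antitoneᵘ u≤u′ C (to (regionBases-represents n d u′ l C) C∈))

PredFace⁻ : ∀ {n} d {u l τ} → PredFace n d u l τ → Σ ℕ λ d′ → d ≡ suc d′ × Face n d′ u l τ
PredFace⁻ (suc d) τ∈F = d , refl , τ∈F

FaceNear : ∀ n (d : ℕ) (u l : ℕ → ℕ) → Sub n → Set
FaceNear n d u l τ = Σ ℕ λ e → e ≤ d × d ≤ suc e × Face n e u l τ

FaceNear⁺ : ∀ {n d u l τ} → Face n d u l τ ⊎ PredFace n d u l τ → FaceNear n d u l τ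
FaceNear⁺ {d = d} (inj₁ τ∈F) = d , ≤-refl , n≤1+n d , τ∈F
FaceNear⁺ {d = d} (inj₂ τ∈P) with PredFace⁻ d τ∈P
... | e , refl , τ∈F = e , n≤1+n e , ≤-refl , τ∈F

FaceNear⁻ : ∀ {n d u l τ} → FaceNear n d u l τ → Face n d u l τ ⊎ PredFace n d u l τ
FaceNear⁻ (e , e≤d , d≤1+e , τ∈F) with m≤n⇒m<n∨m≡n e≤d
... | inj₂ refl = inj₁ τ∈F
... | inj₁ e<d with ≤-antisym e<d d≤1+e
...   | refl = inj₂ τ∈F

suc≤⇒ : ∀ {b k} → suc b ≤ k → Σ ℕ λ k′ → k ≡ suc k′ × b ≤ k′
suc≤⇒ (s≤s b≤k′) = _ , refl , b≤k′

≡true⇔⇒≡ : ∀ {a b : Bool} → a ≡ true ⇔ b ≡ true → a ≡ b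
≡true⇔⇒≡ {true}  {true}  _ = refl
≡true⇔⇒≡ {false} {false} _ = refl
≡true⇔⇒≡ {true}  {false} a⇔b = sym (to a⇔b refl)
≡true⇔⇒≡ {false} {true}  a⇔b = from a⇔b refl

module _ (Λ : LamFam) (isΛ : IsLambdaFamily Λ) where

  open IsLambdaFamily isΛ

  module OnRegion {n d} {u l : ℕ → ℕ} (Bs : List (Sub (suc n))) (rep : Represents Bs (InRegion (suc n) d u l)) where


    private
      Λ⁺ : Sub (suc n) → Sub (suc n)
      Λ⁺ = Λ (suc n) Bs

      M : ∀ {B} → B ∈ Bs → IsMatroid Bs
      M B∈ = regionMatroid Bs rep (_ , B∈)

    endpoint : ∀ B → B ∈ Bs → u (suc n) ≤ d × d ≤ l (suc n)
    endpoint B B∈ = inRegion-endpoint B (to (rep B) B∈)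

    Λ⁺-onto : ∀ τ → Slex Bs τ → Σ (Sub (suc n)) λ B → B ∈ Bs × Λ⁺ B ≡ τ
    Λ⁺-onto τ τ∈S = onto (suc n) Bs (M (proj₂ (Slex-nonempty Bs τ τ∈S))) τ τ∈S

    Λ⁺-into : ∀ B → B ∈ Bs → Slex Bs (Λ⁺ B)
    Λ⁺-into B B∈ = into (suc n) Bs (M B∈) B B∈

    Λ⁺-injective : ∀ B B′ → B ∈ Bs → B′ ∈ Bs → Λ⁺ B ≡ Λ⁺ B′ → B ≡ B′
    Λ⁺-injective B B′ B∈ = injective (suc n) Bs (M B∈) B B′ B∈

    module Deletion {B} (B∈ : B ∈ Bs) (lastB : last B ≡ false) where
      D : List (Sub n)
      D = deleteLast Bs
      D-rep : Represents D (InRegion n d u l)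
      D-rep = deleteLast-represents Bs rep B B∈ lastB
      MD : IsMatroid D
      MD = regionMatroid D D-rep (_ , init∈deleteLast Bs B B∈ lastB)

      Λ⁺-deletion : ∀ B′ → B′ ∈ Bs → last B′ ≡ false → Λ⁺ B′ ≡ Λ n D (init B′) ∷ʳ false
      Λ⁺-deletion B′ B′∈ = recDel n Bs (M B∈) B′ B′∈

    module Contraction {B} (B∈ : B ∈ Bs) (lastB : last B ≡ true) where
      K : List (Sub n)
      K = contractLast Bs
      K-rep : Σ ℕ λ d′ → d ≡ suc d′ × Represents K (InRegion n d′ u l)
      K-rep = contractLast-represents Bs rep B B∈ lastB
      MK : IsMatroid K
      MK = regionMatroid K (proj₂ (proj₂ K-rep)) (_ , init∈contractLast Bs B B∈ lastB)

      init-Λ⁺-contraction : ∀ B′ → B′ ∈ Bs → last B′ ≡ true → init (Λ⁺ B′) ≡ Λ n K (init B′)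
      init-Λ⁺-contraction B′ B′∈ = recCon n Bs (M B∈) B′ B′∈

    Face-init-Λ⁺ : ∀ B → B ∈ Bs → last B ≡ false → Face n d u l (init (Λ⁺ B))
    Face-init-Λ⁺ B B∈ lastB =
      subst (Face n d u l) (sym (init-∷ʳ≡ (Λ⁺-deletion B B∈ lastB)))
            (to (Slex⇔Face D-rep _) (into n D MD (init B) (init∈deleteLast Bs B B∈ lastB)))
      where open Deletion B∈ lastB

    PredFace-init-Λ⁺ : ∀ B → B ∈ Bs → last B ≡ true → PredFace n d u l (init (Λ⁺ B))
    PredFace-init-Λ⁺ B B∈ lastB with Contraction.K-rep B∈ lastB
    ... | d′ , refl , K-rep =
      subst (Face n d′ u l) (sym (init-Λ⁺-contraction B B∈ lastB))
            (to (Slex⇔Face K-rep _) (into n K MK (init B) (init∈contractLast Bs B B∈ lastB)))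
      where open Contraction B∈ lastB using (K; MK; init-Λ⁺-contraction)

    last-B≡true : ∀ B → B ∈ Bs → last (Λ⁺ B) ≡ true → last B ≡ true
    last-B≡true B B∈ lastΛB with last B in lastB
    ... | true  = refl
    ... | false = ⊥-elim (false≢true (trans (sym (last-∷ʳ≡ (Λ⁺-deletion B B∈ lastB))) lastΛB))
      where open Deletion B∈ lastB

    init-Λ⁺-injective : ∀ B B′ → B ∈ Bs → B′ ∈ Bs → last B ≡ true → last B′ ≡ true →
                        init (Λ⁺ B) ≡ init (Λ⁺ B′) → B ≡ B′
    init-Λ⁺-injective B B′ B∈ B′∈ lastB lastB′ same-init =
      trans (split-last≡ B lastB) (trans (cong (_∷ʳ true) init-B≡) (sym (split-last≡ B′ lastB′)))
      where
      open Contraction B∈ lastB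
      init-B≡ : init B ≡ init B′
      init-B≡ = injective n K MK (init B) (init B′)
                  (init∈contractLast Bs B B∈ lastB) (init∈contractLast Bs B′ B′∈ lastB′)
                  (trans (sym (init-Λ⁺-contraction B B∈ lastB)) (trans same-init (init-Λ⁺-contraction B′ B′∈ lastB′)))

    Λ⁺-hits-false : ∀ τ → Face n d u l τ → u (suc n) ≤ d → d ≤ l (suc n) →
                    Σ (Sub n) λ C → C ∷ʳ false ∈ Bs × Λ⁺ (C ∷ʳ false) ≡ τ ∷ʳ false
    Λ⁺-hits-false τ τ∈F lo hi with Face-nonempty τ τ∈F
    ... | C₀ , C₀∈R = C , C∷ʳfalse∈ , trans (Λ⁺-deletion (C ∷ʳ false) C∷ʳfalse∈ (last-∷ʳ false C)) Λ-D-C≡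
      where
      B₀∈ : C₀ ∷ʳ false ∈ Bs
      B₀∈ = from (rep _) (inRegion-∷ʳ-false⁺ C₀ C₀∈R lo hi)
      open Deletion B₀∈ (last-∷ʳ false C₀)
      hit : Σ (Sub n) λ C → C ∈ D × Λ n D C ≡ τ
      hit = onto n D MD τ (from (Slex⇔Face D-rep τ) τ∈F)
      C : Sub n
      C = proj₁ hit
      C∷ʳfalse∈ : C ∷ʳ false ∈ Bs
      C∷ʳfalse∈ = to (∈-deleteLast Bs _ B₀∈ (last-∷ʳ false C₀) C) (proj₁ (proj₂ hit))
      Λ-D-C≡ : Λ n D (init (C ∷ʳ false)) ∷ʳ false ≡ τ ∷ʳ false
      Λ-D-C≡ = cong (_∷ʳ false) (trans (cong (Λ n D) (init-∷ʳ false C)) (proj₂ (proj₂ hit)))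

    Λ⁺-hits-true : ∀ τ → PredFace n d u l τ → u (suc n) ≤ d → d ≤ l (suc n) →
                   Σ (Sub n) λ C → C ∷ʳ true ∈ Bs × init (Λ⁺ (C ∷ʳ true)) ≡ τ
    Λ⁺-hits-true τ τ∈P lo hi with PredFace⁻ d τ∈P
    ... | d′ , refl , τ∈F with Face-nonempty τ τ∈F
    ...   | C₀ , C₀∈R with from (rep (C₀ ∷ʳ true)) (inRegion-∷ʳ-true⁺ C₀ C₀∈R lo hi)
    ...     | B₀∈ with Contraction.K-rep B₀∈ (last-∷ʳ true C₀)
    ...       | _ , refl , K-rep =
      C , C∷ʳtrue∈ , trans (init-Λ⁺-contraction (C ∷ʳ true) C∷ʳtrue∈ (last-∷ʳ true C)) Λ-K-C≡
      where
      open Contraction B₀∈ (last-∷ʳ true C₀) using (K; MK; init-Λ⁺-contraction)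
      hit : Σ (Sub n) λ C → C ∈ K × Λ n K C ≡ τ
      hit = onto n K MK τ (from (Slex⇔Face K-rep τ) τ∈F)
      C : Sub n
      C = proj₁ hit
      C∷ʳtrue∈ : C ∷ʳ true ∈ Bs
      C∷ʳtrue∈ = to (∈-contractLast Bs _ B₀∈ (last-∷ʳ true C₀) C) (proj₁ (proj₂ hit))
      Λ-K-C≡ : Λ n K (init (C ∷ʳ true)) ≡ τ
      Λ-K-C≡ = trans (cong (Λ n K) (init-∷ʳ true C)) (proj₂ (proj₂ hit))

    Slex-∷ʳ-false⁻ : ∀ τ → Slex Bs (τ ∷ʳ false) → Face n d u l τ ⊎ PredFace n d u l τ
    Slex-∷ʳ-false⁻ τ τ∈S with Λ⁺-onto _ τ∈S
    ... | B , B∈ , ΛB≡ with last B in lastB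
    ...   | false = inj₁ (subst (Face n d u l) (init-∷ʳ≡ ΛB≡) (Face-init-Λ⁺ B B∈ lastB))
    ...   | true  = inj₂ (subst (PredFace n d u l) (init-∷ʳ≡ ΛB≡) (PredFace-init-Λ⁺ B B∈ lastB))

    Slex-∷ʳ-true⁻ : ∀ τ → Slex Bs (τ ∷ʳ true) → Face n d u l τ × PredFace n d u l τ
    Slex-∷ʳ-true⁻ τ τ∈S with Λ⁺-onto _ τ∈S
    ... | B , B∈ , ΛB≡ = τ∈F , subst (PredFace n d u l) (init-∷ʳ≡ ΛB≡) (PredFace-init-Λ⁺ B B∈ lastB)
      where
      lastB : last B ≡ true
      lastB = last-B≡true B B∈ (last-∷ʳ≡ ΛB≡)
      τ∈F : Face n d u l τ
      τ∈F with Λ⁺-onto _ (Slex-∷ʳ-true⇒false Bs τ τ∈S)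
      ... | B′ , B′∈ , ΛB′≡ with last B′ in lastB′
      ...   | false = subst (Face n d u l) (init-∷ʳ≡ ΛB′≡) (Face-init-Λ⁺ B′ B′∈ lastB′)
      ...   | true  =
        ⊥-elim (false≢true (∷ʳ-injectiveʳ τ τ (trans (sym ΛB′≡) (trans (cong Λ⁺ (sym B≡B′)) ΛB≡))))
        where
        B≡B′ : B ≡ B′
        B≡B′ = init-Λ⁺-injective B B′ B∈ B′∈ lastB lastB′ (trans (init-∷ʳ≡ ΛB≡) (sym (init-∷ʳ≡ ΛB′≡)))

    Slex-∷ʳ-false⁺ˡ : ∀ τ → Face n d u l τ → u (suc n) ≤ d → d ≤ l (suc n) → Slex Bs (τ ∷ʳ false)
    Slex-∷ʳ-false⁺ˡ τ τ∈F lo hi with Λ⁺-hits-false τ τ∈F lo hi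
    ... | C , C∈ , ΛC≡ = subst (Slex Bs) ΛC≡ (Λ⁺-into _ C∈)

    Slex-∷ʳ-false⁺ʳ : ∀ τ → PredFace n d u l τ → u (suc n) ≤ d → d ≤ l (suc n) → Slex Bs (τ ∷ʳ false)
    Slex-∷ʳ-false⁺ʳ τ τ∈P lo hi with Λ⁺-hits-true τ τ∈P lo hi
    ... | C , C∈ , init≡ with last (Λ⁺ (C ∷ʳ true)) in lastΛ
    ...   | false = subst (Slex Bs) (≡-∷ʳ init≡ lastΛ) (Λ⁺-into _ C∈)
    ...   | true  = Slex-∷ʳ-true⇒false Bs τ (subst (Slex Bs) (≡-∷ʳ init≡ lastΛ) (Λ⁺-into _ C∈))

    -- Λ⁺ (C ∷ʳ true) cannot be τ ∷ʳ false: that is already the image of a basis avoiding the last element.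
    Slex-∷ʳ-true⁺ : ∀ τ → Face n d u l τ → PredFace n d u l τ →
                    u (suc n) ≤ d → d ≤ l (suc n) → Slex Bs (τ ∷ʳ true)
    Slex-∷ʳ-true⁺ τ τ∈F τ∈P lo hi with Λ⁺-hits-true τ τ∈P lo hi
    ... | C , C∈ , init≡ with last (Λ⁺ (C ∷ʳ true)) in lastΛ
    ...   | true  = subst (Slex Bs) (≡-∷ʳ init≡ lastΛ) (Λ⁺-into _ C∈)
    ...   | false with Λ⁺-hits-false τ τ∈F lo hi
    ...     | C′ , C′∈ , ΛC′≡ = ⊥-elim (false≢true (∷ʳ-injectiveʳ C′ C
                (Λ⁺-injective _ _ C′∈ C∈ (trans ΛC′≡ (sym (≡-∷ʳ init≡ lastΛ))))))

    last-Λ⁺≡true⇔ : ∀ B → B ∈ Bs → last B ≡ true → last (Λ⁺ B) ≡ true ⇔ Face n d u l (init (Λ⁺ B))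
    last-Λ⁺≡true⇔ B B∈ lastB = mk⇔ ⇒ ⇐
      where
      ⇒ : last (Λ⁺ B) ≡ true → Face n d u l (init (Λ⁺ B))
      ⇒ lastΛ = proj₁ (Slex-∷ʳ-true⁻ _ (subst (Slex Bs) (≡-∷ʳ refl lastΛ) (Λ⁺-into B B∈)))
      ⇐ : Face n d u l (init (Λ⁺ B)) → last (Λ⁺ B) ≡ true
      ⇐ τ∈F with Λ⁺-onto _ (Slex-∷ʳ-true⁺ _ τ∈F (PredFace-init-Λ⁺ B B∈ lastB)
                                          (proj₁ (endpoint B B∈)) (proj₂ (endpoint B B∈)))
      ... | B′ , B′∈ , ΛB′≡ = trans (cong (λ X → last (Λ⁺ X)) B≡B′) (last-∷ʳ≡ ΛB′≡)
        where
        B≡B′ : B ≡ B′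
        B≡B′ = init-Λ⁺-injective B B′ B∈ B′∈ lastB (last-B≡true B′ B′∈ (last-∷ʳ≡ ΛB′≡)) (sym (init-∷ʳ≡ ΛB′≡))

  private
    module R (n d : ℕ) (u l : ℕ → ℕ) = OnRegion (regionBases (suc n) d u l) (regionBases-represents (suc n) d u l)

  -- Face-interval does not mention Λ, but its proof runs on the recursion for S_lex that the bijections Λ provide.
  Face-interval : ∀ n {d₁ d₂ k u₁ u₂ l} τ → d₂ ≤ k → k ≤ d₁ →
                  Face n d₁ u₁ l τ → Face n d₂ u₂ l τ → Face n k u₂ l τ
  Face-interval zero {d₁} {d₂} {k} {u₁} {u₂} {l} τ d₂≤k k≤d₁ τ∈F₁ τ∈F₂
    with Face-nonempty {d = d₁} {u₁} {l} τ τ∈F₁ | Face-nonempty {d = d₂} {u₂} {l} τ τ∈F₂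
  ... | [] , refl , _ | [] , refl , _ = subst (λ k → Face zero k u₂ l τ) (sym (n≤0⇒n≡0 k≤d₁)) τ∈F₂
  Face-interval (suc n) {d₁} {d₂} {k} {u₁} {u₂} {l} τ d₂≤k k≤d₁ τ∈F₁ τ∈F₂ =
    subst (Face (suc n) k u₂ l) (sym (split-last τ))
          (step (init τ) (last τ) (subst (Face (suc n) d₁ u₁ l) (split-last τ) τ∈F₁)
                                  (subst (Face (suc n) d₂ u₂ l) (split-last τ) τ∈F₂))
    where
    lo : u₂ (suc n) ≤ k
    lo = ≤-trans (proj₁ (inRegion-endpoint _ (proj₂ (Face-nonempty {d = d₂} {u₂} {l} τ τ∈F₂)))) d₂≤k
    hi : k ≤ l (suc n)
    hi = ≤-trans k≤d₁ (proj₂ (inRegion-endpoint _ (proj₂ (Face-nonempty {d = d₁} {u₁} {l} τ τ∈F₁))))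

    combine : ∀ σ → FaceNear n d₁ u₁ l σ → FaceNear n d₂ u₂ l σ → FaceNear n k u₂ l σ
    combine σ (x , _ , d₁≤1+x , σ∈F₁) (y , y≤d₂ , _ , σ∈F₂) with k ≤? x
    ... | yes k≤x = k , ≤-refl , n≤1+n k , Face-interval n σ (≤-trans y≤d₂ d₂≤k) k≤x σ∈F₁ σ∈F₂
    ... | no k≰x with y ≤? x
    ...   | yes y≤x = x , <⇒≤ (≰⇒> k≰x) , ≤-trans k≤d₁ d₁≤1+x , Face-interval n σ y≤x ≤-refl σ∈F₁ σ∈F₂
    ...   | no y≰x  =
      y , ≤-trans y≤d₂ d₂≤k , ≤-trans k≤d₁ (≤-trans d₁≤1+x (≤-trans (≰⇒> y≰x) (n≤1+n y))) , σ∈F₂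

    step : ∀ σ b → Face (suc n) d₁ u₁ l (σ ∷ʳ b) → Face (suc n) d₂ u₂ l (σ ∷ʳ b) →
           Face (suc n) k u₂ l (σ ∷ʳ b)
    step σ false σ∈F₁ σ∈F₂
      with FaceNear⁻ (combine σ (FaceNear⁺ (R.Slex-∷ʳ-false⁻ n d₁ u₁ l σ σ∈F₁))
                                (FaceNear⁺ (R.Slex-∷ʳ-false⁻ n d₂ u₂ l σ σ∈F₂)))
    ... | inj₁ σ∈F = R.Slex-∷ʳ-false⁺ˡ n k u₂ l σ σ∈F lo hi
    ... | inj₂ σ∈P = R.Slex-∷ʳ-false⁺ʳ n k u₂ l σ σ∈P lo hi
    step σ true σ∈F₁ σ∈F₂ with R.Slex-∷ʳ-true⁻ n d₁ u₁ l σ σ∈F₁ | R.Slex-∷ʳ-true⁻ n d₂ u₂ l σ σ∈F₂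
    ... | σ∈F₁′ , _ | _ , σ∈P₂ with PredFace⁻ d₂ σ∈P₂
    ...   | b , refl , σ∈F₂′ with suc≤⇒ d₂≤k
    ...     | k′ , refl , b≤k′ =
      R.Slex-∷ʳ-true⁺ n k u₂ l σ (Face-interval n σ (≤-trans b≤k′ (n≤1+n k′)) k≤d₁ σ∈F₁′ σ∈F₂′)
                                 (Face-interval n σ b≤k′ (≤-trans (n≤1+n k′) k≤d₁) σ∈F₁′ σ∈F₂′) lo hi

  Λ-restricts : ∀ n {d u u′ l} {Bs Bs′ : List (Sub n)} →
    Represents Bs (InRegion n d u l) → Represents Bs′ (InRegion n d u′ l) →
    (∀ j → j ≤ n → u j ≤ u′ j) → ∀ B → B ∈ Bs′ → Λ n Bs B ≡ Λ n Bs′ B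
  Λ-restricts zero {Bs = Bs} {Bs′} _ _ _ B _ with Λ zero Bs B | Λ zero Bs′ B
  ... | [] | [] = refl
  Λ-restricts (suc n) {d} {u} {u′} {l} {Bs} {Bs′} rep rep′ u≤u′ B B∈′
    with from (rep B) (inRegion-antitoneᵘ u≤u′ B (to (rep′ B) B∈′)) | last B in lastB
  ... | B∈ | false = begin
      Λ (suc n) Bs B                          ≡⟨ recDel n Bs (regionMatroid Bs rep (B , B∈)) B B∈ lastB ⟩
      Λ n (deleteLast Bs) (init B) ∷ʳ false   ≡⟨ cong (_∷ʳ false) deletions-agree ⟩
      Λ n (deleteLast Bs′) (init B) ∷ʳ false  ≡⟨ sym (recDel n Bs′ (regionMatroid Bs′ rep′ (B , B∈′)) B B∈′ lastB) ⟩
      Λ (suc n) Bs′ B                         ∎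
    where
    open ≡-Reasoning
    deletions-agree : Λ n (deleteLast Bs) (init B) ≡ Λ n (deleteLast Bs′) (init B)
    deletions-agree = Λ-restricts n (deleteLast-represents Bs rep B B∈ lastB) (deleteLast-represents Bs′ rep′ B B∈′ lastB)
                        (below-suc u≤u′) (init B) (init∈deleteLast Bs′ B B∈′ lastB)
  ... | B∈ | true with contractLast-represents Bs rep B B∈ lastB | contractLast-represents Bs′ rep′ B B∈′ lastB
  ...   | d′ , refl , K-rep | _ , refl , K′-rep = trans (≡-∷ʳ same-init same-last) (sym (split-last _))
    where
    module M  = OnRegion Bs rep
    module M′ = OnRegion Bs′ rep′
    τ : Sub n
    τ = init (Λ (suc n) Bs′ B)
    same-init : init (Λ (suc n) Bs B) ≡ τ
    same-init = trans (recCon n Bs (regionMatroid Bs rep (B , B∈)) B B∈ lastB)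
                  (trans (Λ-restricts n K-rep K′-rep (below-suc u≤u′) (init B) (init∈contractLast Bs′ B B∈′ lastB))
                         (sym (recCon n Bs′ (regionMatroid Bs′ rep′ (B , B∈′)) B B∈′ lastB)))
    faces-agree : Face n (suc d′) u l τ ⇔ Face n (suc d′) u′ l τ
    faces-agree = mk⇔ (λ τ∈F → Face-interval n τ (n≤1+n d′) ≤-refl τ∈F (M′.PredFace-init-Λ⁺ B B∈′ lastB))
                      (Face-antitoneᵘ (below-suc u≤u′) τ)
    last-Λ⇔ : last (Λ (suc n) Bs B) ≡ true ⇔ Face n (suc d′) u l τ
    last-Λ⇔ = subst (λ σ → last (Λ (suc n) Bs B) ≡ true ⇔ Face n (suc d′) u l σ) same-init
                    (M.last-Λ⁺≡true⇔ B B∈ lastB)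
    same-last : last (Λ (suc n) Bs B) ≡ last (Λ (suc n) Bs′ B)
    same-last = ≡true⇔⇒≡ (⇔-sym (M′.last-Λ⁺≡true⇔ B B∈′ lastB) ⇔-∘ (faces-agree ⇔-∘ last-Λ⇔))

weaklyAbove⇔ : ∀ {n} (U C : Vec Bool n) → WeaklyAbove U C ⇔ (∀ j → j ≤ n → pre j U ≤ pre j C)
weaklyAbove⇔ U C = mk⇔
  (λ U≥C j j≤n → subst (λ t → pre t U ≤ pre t C) (toℕ-fromℕ< (s≤s j≤n)) (U≥C (fromℕ< (s≤s j≤n))))
  (λ U≥C j → U≥C (toℕ j) (≤-pred (toℕ<n j)))

basesUL-represents : ∀ n d (U L : Vec Bool n) → Represents (basesUL n d U L) (InRegion n d (λ j → pre j U) (λ j → pre j L))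
basesUL-represents n d U L C = mk⇔ to′ from′
  where
  to′ : C ∈ basesUL n d U L → InRegion n d (λ j → pre j U) (λ j → pre j L) C
  to′ C∈ with proj₂ (∈-filter⁻ (inPUL? n d U L) {xs = allSubs n} C∈)
  ... | cnt , U≥C , C≥L = cnt , λ j j≤n → to (weaklyAbove⇔ U C) U≥C j j≤n , to (weaklyAbove⇔ C L) C≥L j j≤n
  from′ : InRegion n d (λ j → pre j U) (λ j → pre j L) C → C ∈ basesUL n d U L
  from′ (cnt , bnd) = ∈-filter⁺ (inPUL? n d U L) (∈-allSubs C)
    (cnt , from (weaklyAbove⇔ U C) (λ j j≤n → proj₁ (bnd j j≤n))
         , from (weaklyAbove⇔ C L) (λ j j≤n → proj₂ (bnd j j≤n)))

corollary4p9 : (Λ : LamFam) → IsLambdaFamily Λ →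
    (n d : ℕ) (U U' L : Vec Bool n) →
    InP n d U → InP n d U' → InP n d L →
    WeaklyAbove U U' → WeaklyAbove U' L →
    (∀ B → B ∈ basesUL n d U' L →
       Λ n (basesUL n d U L) B ≡ Λ n (basesUL n d U' L) B)
    × (∀ τ → Slex (basesUL n d U' L) τ → Slex (basesUL n d U L) τ)
corollary4p9 Λ isΛ n d U U′ L _ _ _ U≥U′ _ =
  Λ-restricts Λ isΛ n (basesUL-represents n d U L) (basesUL-represents n d U′ L) U≤U′ ,
  Slex-antitone λ C C∈ → from (basesUL-represents n d U L C)
                            (inRegion-antitoneᵘ U≤U′ C (to (basesUL-represents n d U′ L C) C∈))
  where
  U≤U′ : ∀ j → j ≤ n → pre j U ≤ pre j U′
  U≤U′ = to (weaklyAbove⇔ U U′) U≥U′
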